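{- For every $n\ge 2$ and every signature $\sigma$ on the path $P_n$, the signed path $P_n^\sigma=(P_n,\sigma)$ has metric dimension $\dim(P_n^\sigma)=1$.
   Context: A signed graph is $(G,\sigma)$ with $\sigma:E(G)\to\{+1,-1\}$. The sign of a path is the product of its edge signs; in a signed tree the unique $u$–$v$ path has sign $\sigma(uv)$ and the signed distance is $d_\Sigma(u,v)=\sigma(uv)d(u,v)$, $d$ the graph distance. For an ordered vertex set $W=(w_1,\dots,w_k)$, $r(v|W)=(d_\Sigma(v,w_1),\dots,d_\Sigma(v,w_k))$; $W$ is resolving if distinct vertices have distinct representations; $\dim$ is the minimum cardinality of a resolving set. -}

module Defs where

open import Data.Nat using (ℕ; _∸_; _≤_; _<_; _⊔_; _⊓_; ∣_-_∣)
open import Data.Nat.Properties using (_≤?_; _<?_)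
open import Data.Fin using (Fin; toℕ)
open import Data.Integer using (ℤ; _◃_)
open import Data.Sign using (Sign) renaming (_*_ to _*ₛ_)
open import Data.List using (List; map; foldr; length; allFin)
open import Data.List.Relation.Unary.Unique.Propositional using (Unique)
open import Data.Product using (Σ; _×_)
open import Relation.Binary.PropositionalEquality using (_≡_)
open import Relation.Nullary using (yes; no)

-- The path P_n has vertex set Fin n (vertices 0,…,n-1) and edges
-- e_k = {k, k+1} for k : Fin (n ∸ 1).  A signature assigns a sign to each edge.
Signature : ℕ → Set
Signature n = Fin (n ∸ 1) → Sign

dist : ∀ {n} → Fin n → Fin n → ℕ
dist u v = ∣ toℕ u - toℕ v ∣

-- does edge e_k lie on the unique u–v path (i.e. min(u,v) ≤ k < max(u,v))?
-- contributes its sign if so, + otherwise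
edgeFactor : ℕ → ℕ → ∀ {m} → (Fin m → Sign) → Fin m → Sign
edgeFactor a b σ k with (a ⊓ b) ≤? toℕ k | toℕ k <? (a ⊔ b)
... | yes _ | yes _ = σ k
... | _     | _     = Sign.+

pathSign : ∀ {n} → Signature n → Fin n → Fin n → Sign
pathSign {n} σ u v =
  foldr (λ k s → edgeFactor (toℕ u) (toℕ v) σ k *ₛ s) Sign.+ (allFin (n ∸ 1))

signedDist : ∀ {n} → Signature n → Fin n → Fin n → ℤ
signedDist σ u v = pathSign σ u v ◃ dist u v

rep : ∀ {n} → Signature n → Fin n → List (Fin n) → List ℤ
rep σ v W = map (signedDist σ v) W

Resolving : ∀ {n} → Signature n → List (Fin n) → Set
Resolving {n} σ W = (u v : Fin n) → rep σ u W ≡ rep σ v W → u ≡ v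

MetricDim : (n : ℕ) → Signature n → ℕ → Set
MetricDim n σ k =
  Σ (List (Fin n)) (λ W → Unique W × length W ≡ k × Resolving σ W)
  × ((W : List (Fin n)) → Unique W → Resolving σ W → k ≤ length W)

{-# OPTIONS --safe #-}
module Submission where

-- The signed distance to the end vertex 0 has absolute value d(v, 0) = v
-- whatever the signature, so {0} alone resolves; the empty set cannot
-- resolve a path with two distinct vertices.

open import Defs
open import Data.Nat using (ℕ; _≤_; suc; s≤s; z≤n)
open import Data.Nat.Properties using (∣-∣-identityʳ)
open import Data.Fin using (Fin; toℕ; zero) renaming (suc to fsuc)
open import Data.Fin.Properties using (toℕ-injective)
open import Data.Integer using (∣_∣)
open import Data.Integer.Properties using (abs-◃)
open import Data.List using (List; []; _∷_; [_]; length)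
open import Data.List.Relation.Unary.AllPairs using ([]; _∷_)
open import Data.List.Relation.Unary.All using ([])
open import Data.List.Properties using (∷-injectiveˡ)
open import Data.Empty using (⊥-elim)
open import Data.Product using (_,_)
open import Relation.Binary.PropositionalEquality using (_≡_; refl; cong; module ≡-Reasoning)
open import Relation.Nullary using (¬_)

abs-signedDist : ∀ {n} (σ : Signature n) (u v : Fin n) → ∣ signedDist σ u v ∣ ≡ dist u v
abs-signedDist σ u v = abs-◃ (pathSign σ u v) (dist u v)

dist-zeroʳ : ∀ {n} (v : Fin (suc n)) → dist v zero ≡ toℕ v
dist-zeroʳ v = ∣-∣-identityʳ (toℕ v)

zero-resolving : ∀ {n} (σ : Signature (suc n)) → Resolving σ [ zero ]
zero-resolving σ u v eq = toℕ-injective (begin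
  toℕ u                        ≡⟨ dist-zeroʳ u ⟨
  dist u zero                  ≡⟨ abs-signedDist σ u zero ⟨
  ∣ signedDist σ u zero ∣      ≡⟨ cong ∣_∣ (∷-injectiveˡ eq) ⟩
  ∣ signedDist σ v zero ∣      ≡⟨ abs-signedDist σ v zero ⟩
  dist v zero                  ≡⟨ dist-zeroʳ v ⟩
  toℕ v                        ∎)
  where open ≡-Reasoning

[]-not-resolving : ∀ {n} (σ : Signature (suc (suc n))) → ¬ Resolving σ []
[]-not-resolving σ resolves with resolves zero (fsuc zero) refl
... | ()

resolving-nonempty : ∀ {n} (σ : Signature (suc (suc n))) (W : List (Fin (suc (suc n)))) →
                     Resolving σ W → 1 ≤ length W
resolving-nonempty σ []      resolves = ⊥-elim ([]-not-resolving σ resolves)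
resolving-nonempty σ (_ ∷ _) _        = s≤s z≤n

theorem2p8 : (n : ℕ) → 2 ≤ n → (σ : Signature n) → MetricDim n σ 1
theorem2p8 (suc (suc n)) (s≤s (s≤s z≤n)) σ =
  ([ zero ] , [] ∷ [] , refl , zero-resolving σ) ,
  λ W _ → resolving-nonempty σ W
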